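{- Let $k\geq 1$ be an integer and let $H$ be a graph with $\chi(H)=3$, containing a critical edge $xy$, and with odd girth at least $2k+1$. Then: (1) there is a partition $V(H)=A_1\cup A_2\cup A_3\cup B$ into disjoint sets with $A_1=\{x\}$, $A_2=\{y\}$ such that every edge of $H$ either has one endpoint in $A_3$ and the other in $B$, or has one endpoint in $A_i$ and the other in $A_{i+1}$ for some $i\in\{1,2,3\}$ (indices modulo $3$); (2) if $k\geq 2$, there is a partition $V(H)=A_1\cup A_2\cup\dots\cup A_{2k+1}$ into disjoint sets with $A_1=\{x\}$, $A_2=\{y\}$ such that every edge of $H$ has one endpoint in $A_i$ and the other in $A_{i+1}$ for some $i\in\{1,\dots,2k+1\}$ (indices modulo $2k+1$). In particular, $H$ is homomorphic to $C_{2k+1}$.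
   Context: An edge $xy$ of $H$ is critical if $\chi(H-xy)<\chi(H)$. The odd girth of $H$ is the length of a shortest odd cycle in $H$. $C_m$ is the cycle of length $m$. -}

module Defs where

open import Data.Nat using (ℕ; zero; suc; _+_; _*_; _≤_)
open import Data.Fin using (Fin; toℕ)
open import Data.Bool using (Bool; true; false; T; _∧_; not)
open import Data.Maybe using (Maybe; just; nothing)
open import Data.Product using (Σ; _×_; ∃-syntax)
open import Data.Sum using (_⊎_)
open import Relation.Nullary using (¬_)
open import Relation.Binary.PropositionalEquality using (_≡_; _≢_)
open import Data.Fin using (_≟_)
open import Relation.Nullary.Decidable using (⌊_⌋)
open import Function.Definitions using (Injective)

record Graph (n : ℕ) : Set where
  field
    adj    : Fin n → Fin n → Bool
    sym    : ∀ u v → adj u v ≡ adj v u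
    irrefl : ∀ v → adj v v ≡ false

open Graph public

Adj : ∀ {n} → Graph n → Fin n → Fin n → Set
Adj G u v = T (adj G u v)

deleteEdge : ∀ {n} → (G : Graph n) → Fin n → Fin n → Graph n
deleteEdge {n} G x y = record
  { adj = λ u v → adj G u v ∧ not (isxy u v)
  ; sym = symP
  ; irrefl = λ v → irrP v
  }
  where
  isxy : Fin n → Fin n → Bool
  isxy u v = (⌊ u ≟ x ⌋ ∧ ⌊ v ≟ y ⌋) Data.Bool.∨ (⌊ u ≟ y ⌋ ∧ ⌊ v ≟ x ⌋)
  open import Relation.Binary.PropositionalEquality using (refl; cong₂)
  open import Data.Bool.Properties using (∧-comm; ∨-comm)
  isxy-sym : ∀ u v → isxy u v ≡ isxy v u
  isxy-sym u v rewrite ∧-comm ⌊ u ≟ x ⌋ ⌊ v ≟ y ⌋ | ∧-comm ⌊ u ≟ y ⌋ ⌊ v ≟ x ⌋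
    = ∨-comm (⌊ v ≟ y ⌋ ∧ ⌊ u ≟ x ⌋) (⌊ v ≟ x ⌋ ∧ ⌊ u ≟ y ⌋)
  symP : ∀ u v → (adj G u v ∧ not (isxy u v)) ≡ (adj G v u ∧ not (isxy v u))
  symP u v = cong₂ (λ a b → a ∧ not b) (Graph.sym G u v) (isxy-sym u v)
  irrP : ∀ v → (adj G v v ∧ not (isxy v v)) ≡ false
  irrP v rewrite Graph.irrefl G v = refl

ProperColouring : ∀ {n} → Graph n → (m : ℕ) → (Fin n → Fin m) → Set
ProperColouring G m c = ∀ u v → Adj G u v → c u ≢ c v

Colourable : ∀ {n} → Graph n → ℕ → Set
Colourable {n} G m = Σ (Fin n → Fin m) (ProperColouring G m)

ChromaticNumber≡ : ∀ {n} → Graph n → ℕ → Set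
ChromaticNumber≡ G m = Colourable G m × (∀ j → Colourable G j → m ≤ j)

ChromaticNumber< : ∀ {n} → Graph n → ℕ → Set
ChromaticNumber< G m = ∃[ j ] (suc j ≤ m × Colourable G j)

CriticalEdge : ∀ {n} → Graph n → Fin n → Fin n → Set
CriticalEdge G x y =
  Adj G x y × (∀ m → ChromaticNumber≡ G m → ChromaticNumber< (deleteEdge G x y) m)

CycStep : (m : ℕ) → Fin m → Fin m → Set
CycStep m i j = (suc (toℕ i) ≡ toℕ j) ⊎ (suc (toℕ i) ≡ m × toℕ j ≡ 0)

CycAdjacent : (m : ℕ) → Fin m → Fin m → Set
CycAdjacent m i j = CycStep m i j ⊎ CycStep m j i

record Cycle {n} (G : Graph n) (m : ℕ) : Set where
  field
    len≥3  : 3 ≤ m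
    vert   : Fin m → Fin n
    inj    : Injective _≡_ _≡_ vert
    edges  : ∀ i j → CycStep m i j → Adj G (vert i) (vert j)

Odd : ℕ → Set
Odd m = ∃[ t ] (m ≡ suc (2 * t))

OddGirth≥ : ∀ {n} → Graph n → ℕ → Set
OddGirth≥ G g = ∀ m → Odd m → Cycle G m → g ≤ m

-- (1) partition V = A₁ ∪ A₂ ∪ A₃ ∪ B, encoded by f : V → Maybe (Fin 3)
-- (just i ↦ A_{i+1}, nothing ↦ B)
Partition1 : ∀ {n} → Graph n → Fin n → Fin n → Set
Partition1 {n} G x y = Σ (Fin n → Maybe (Fin 3)) λ f →
    (∀ v → (f v ≡ just Fin.zero → v ≡ x) × (v ≡ x → f v ≡ just Fin.zero))
  × (∀ v → (f v ≡ just (Fin.suc Fin.zero) → v ≡ y) × (v ≡ y → f v ≡ just (Fin.suc Fin.zero)))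
  × (∀ u v → Adj G u v →
        ((f u ≡ just (Fin.suc (Fin.suc Fin.zero)) × f v ≡ nothing)
         ⊎ (f u ≡ nothing × f v ≡ just (Fin.suc (Fin.suc Fin.zero))))
      ⊎ (∃[ i ] ∃[ j ] (f u ≡ just i × f v ≡ just j × CycAdjacent 3 i j)))
  where import Data.Fin as Fin

-- (2) partition V = A₁ ∪ … ∪ A_m, encoded by f : V → Fin m (i ↦ A_{i+1})
Partition2 : ∀ {n} → Graph n → Fin n → Fin n → (m : ℕ) → Set
Partition2 {n} G x y m = Σ (Fin n → Fin m) λ f →
    (∀ v → (toℕ (f v) ≡ 0 → v ≡ x) × (v ≡ x → toℕ (f v) ≡ 0))
  × (∀ v → (toℕ (f v) ≡ 1 → v ≡ y) × (v ≡ y → toℕ (f v) ≡ 1))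
  × (∀ u v → Adj G u v → CycAdjacent m (f u) (f v))

-- Since xy is critical, H − xy has a proper 2-colouring β, and β x = β y because otherwise β
-- would 2-colour H.  For (1), A₃ and B are the remaining vertices on the side opposite to y and
-- on the side of y.  For (2), measure distances from y in H − xy: a shortest y–x path closed by
-- xy is an odd cycle, so x is at distance at least 2k.  Put x at position 0, the vertices at
-- distance d < 2k at position d + 1, and the other vertices at 2k − 1 or 2k according to
-- their colour; parity of distances and the 2-colouring make every edge join consecutive
-- positions modulo 2k + 1.
module Submission where

open import Defs hiding (sym)
open import Data.Nat using (ℕ; zero; suc; _+_; _*_; _≤_; _<_; z≤n; s≤s; s≤s⁻¹; _<?_)
open import Data.Nat.Properties
  using (≤-antisym; ≤-trans; ≤-<-trans; <-≤-trans; ≤-refl; <-irrefl; ≮⇒≥; n≤1+n; +-identityʳ; +-suc; +-comm;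
         +-cancelˡ-≡; *-suc; *-distribˡ-+; suc-injective)
open import Data.Fin using (Fin; toℕ; fromℕ<; inject≤; _≟_)
open import Data.Fin.Patterns using (0F; 1F; 2F)
open import Data.Fin.Properties using (any?; toℕ-injective; toℕ<n; toℕ-fromℕ<; inject≤-injective; 2↔Bool)
open import Data.Bool using (Bool; true; false; T; not; _∧_)
import Data.Bool.Properties as Bool
open import Data.Maybe using (Maybe; just; nothing)
open import Data.Product using (Σ; ∃-syntax; _×_; _,_; proj₁; proj₂)
open import Data.Sum using (_⊎_; inj₁; inj₂)
open import Data.Empty using (⊥-elim)
open import Function using (_∘_; Equivalence; Injection)
open import Function.Properties.Inverse using (↔⇒↣; ↔-sym)
open import Relation.Nullary using (¬_; Dec; yes; no; contradiction)
open import Relation.Nullary.Decidable using (⌊_⌋; T?; toWitness; fromWitness; decidable-stable; _×-dec_)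
open import Relation.Binary.PropositionalEquality

nots : ℕ → Bool → Bool
nots zero b = b
nots (suc t) b = not (nots t b)

nots-even : ∀ s b → nots (2 * s) b ≡ b
nots-even zero b = refl
nots-even (suc s) b = subst (λ t → nots t b ≡ b) (sym (*-suc 2 s))
  (trans (Bool.not-involutive (nots (2 * s) b)) (nots-even s b))

nots-fixed⇒even : ∀ t b → nots t b ≡ b → ∃[ s ] t ≡ 2 * s
nots-fixed⇒even zero b _ = 0 , refl
nots-fixed⇒even (suc zero) b e = contradiction (sym e) (Bool.not-¬ refl)
nots-fixed⇒even (suc (suc t)) b e with nots-fixed⇒even t b (trans (sym (Bool.not-involutive (nots t b))) e)
... | s , refl = suc s , sym (*-suc 2 s)

within1∧≢⇒consecutive : ∀ {m n} → m ≤ suc n → n ≤ suc m → m ≢ n → suc m ≡ n ⊎ suc n ≡ m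
within1∧≢⇒consecutive {zero} {zero} _ _ m≢n = contradiction refl m≢n
within1∧≢⇒consecutive {zero} {suc zero} _ _ _ = inj₁ refl
within1∧≢⇒consecutive {suc zero} {zero} _ _ _ = inj₂ refl
within1∧≢⇒consecutive {suc m} {suc n} (s≤s m≤1+n) (s≤s n≤1+m) 1+m≢1+n
  with within1∧≢⇒consecutive m≤1+n n≤1+m (1+m≢1+n ∘ cong suc)
... | inj₁ e = inj₁ (cong suc e)
... | inj₂ e = inj₂ (cong suc e)
within1∧≢⇒consecutive {zero} {suc (suc _)} _ (s≤s ())
within1∧≢⇒consecutive {suc (suc _)} {zero} (s≤s ()) _

least : (ℕ → Bool) → ℕ → ℕ
least p zero = zero
least p (suc b) with p zero
... | true = zero
... | false = suc (least (p ∘ suc) b)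

least-minimal : ∀ p b s → T (p s) → least p b ≤ s
least-minimal p zero s _ = z≤n
least-minimal p (suc b) s ps with p zero in eq
... | true = z≤n
least-minimal p (suc b) zero ps | false = ⊥-elim (subst T eq ps)
least-minimal p (suc b) (suc s) ps | false = s≤s (least-minimal (p ∘ suc) b s ps)

least-holds : ∀ p b → least p b < b → T (p (least p b))
least-holds p (suc b) lt with p zero in eq
... | true = subst T (sym eq) _
... | false = least-holds (p ∘ suc) b (s≤s⁻¹ lt)

ProperBoolColouring : ∀ {n} → Graph n → (Fin n → Bool) → Set
ProperBoolColouring G β = ∀ u v → Adj G u v → β u ≢ β v

colour-flips : ∀ {n} (G : Graph n) {β} → ProperBoolColouring G β → ∀ {u v} → Adj G u v → β v ≡ not (β u)
colour-flips G proper {u} a = Bool.¬-not (proper u _ a ∘ sym)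

module _ {n} (G : Graph n) where

  Adj-sym : ∀ {u v} → Adj G u v → Adj G v u
  Adj-sym {u} {v} = subst T (Graph.sym G u v)

  Adj-irrefl : ∀ {u v} → Adj G u v → u ≢ v
  Adj-irrefl {u} a refl = subst T (irrefl G u) a

  deleteEdge-⊆ : ∀ {x y u v} → Adj (deleteEdge G x y) u v → Adj G u v
  deleteEdge-⊆ {u = u} {v} = proj₁ ∘ Equivalence.to (Bool.T-∧ {adj G u v})

  deleteEdge-intro : ∀ {x y u v} → Adj G u v → ¬ (u ≡ x × v ≡ y) → ¬ (u ≡ y × v ≡ x)
                   → Adj (deleteEdge G x y) u v
  deleteEdge-intro {x} {y} {u} {v} a ¬xy ¬yx with adj G u v | u ≟ x | v ≟ y | u ≟ y | v ≟ x
  ... | true | yes p | yes q | _     | _     = contradiction (p , q) ¬xy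
  ... | true | _     | _     | yes p | yes q = contradiction (p , q) ¬yx
  ... | true | no _  | _     | no _  | _     = _
  ... | true | no _  | _     | yes _ | no _  = _
  ... | true | yes _ | no _  | no _  | _     = _
  ... | true | yes _ | no _  | yes _ | no _  = _

  colourable-mono : ∀ {j m} → j ≤ m → Colourable G j → Colourable G m
  colourable-mono j≤m (c , proper) =
    (λ v → inject≤ (c v) j≤m) , λ u v a → proper u v a ∘ inject≤-injective j≤m j≤m (c u) (c v)

  colourable₂⇒boolColouring : Colourable G 2 → Σ (Fin n → Bool) (ProperBoolColouring G)
  colourable₂⇒boolColouring (c , proper) =
    Injection.to 2↣Bool ∘ c , λ u v a → proper u v a ∘ Injection.injective 2↣Bool
    where 2↣Bool = ↔⇒↣ 2↔Bool

  boolColouring⇒colourable₂ : ∀ {β} → ProperBoolColouring G β → Colourable G 2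
  boolColouring⇒colourable₂ {β} proper =
    Injection.to Bool↣2 ∘ β , λ u v a → proper u v a ∘ Injection.injective Bool↣2
    where Bool↣2 = ↔⇒↣ (↔-sym 2↔Bool)

  deleteEdge-restore : ∀ {x y β} → ProperBoolColouring (deleteEdge G x y) β → β x ≢ β y
                     → ProperBoolColouring G β
  deleteEdge-restore {x} {y} proper βx≢βy u v a with u ≟ x ×-dec v ≟ y | u ≟ y ×-dec v ≟ x
  ... | yes (refl , refl) | _                 = βx≢βy
  ... | no _              | yes (refl , refl) = βx≢βy ∘ sym
  ... | no ¬xy            | no ¬yx            = proper u v (deleteEdge-intro a ¬xy ¬yx)

criticalEdge⇒almostBipartite : ∀ {n} {H : Graph n} {x y} → ChromaticNumber≡ H 3 → CriticalEdge H x y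
  → Σ (Fin n → Bool) λ β → ProperBoolColouring (deleteEdge H x y) β × β x ≡ β y
criticalEdge⇒almostBipartite {H = H} {x} {y} χ (_ , critical) =
  let j , 1+j≤3 , colouring = critical 3 χ
      β , proper = colourable₂⇒boolColouring H' (colourable-mono H' (s≤s⁻¹ 1+j≤3) colouring)
      H-bipartite = λ β-differ → boolColouring⇒colourable₂ H (deleteEdge-restore H proper β-differ)
  in β , proper , decidable-stable (β x Bool.≟ β y) λ β-differ →
       contradiction (proj₂ χ 2 (H-bipartite β-differ)) λ { (s≤s (s≤s ())) }
  where H' = deleteEdge H x y

CycStepℕ : ℕ → ℕ → ℕ → Set
CycStepℕ m a b = (suc a ≡ b) ⊎ (suc a ≡ m × b ≡ 0)

CycAdjacentℕ : ℕ → ℕ → ℕ → Set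
CycAdjacentℕ m a b = CycStepℕ m a b ⊎ CycStepℕ m b a

CycAdjacentℕ-sym : ∀ {m a b} → CycAdjacentℕ m a b → CycAdjacentℕ m b a
CycAdjacentℕ-sym (inj₁ s) = inj₂ s
CycAdjacentℕ-sym (inj₂ s) = inj₁ s

partition₂-fromℕ : ∀ {n m} (G : Graph n) {x y} (ℓ : Fin n → ℕ) → (∀ v → ℓ v < m)
  → (∀ v → (ℓ v ≡ 0 → v ≡ x) × (v ≡ x → ℓ v ≡ 0))
  → (∀ v → (ℓ v ≡ 1 → v ≡ y) × (v ≡ y → ℓ v ≡ 1))
  → (∀ u v → Adj G u v → CycAdjacentℕ m (ℓ u) (ℓ v))
  → Partition2 G x y m
partition₂-fromℕ G ℓ ℓ<m at-x at-y adjacent =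
  f , (λ v → subst-ℓ v (at-x v)) , (λ v → subst-ℓ v (at-y v))
    , λ u v a → subst₂ (CycAdjacentℕ _) (sym (toℕ-f u)) (sym (toℕ-f v)) (adjacent u v a)
  where
  f = λ v → fromℕ< (ℓ<m v)
  toℕ-f : ∀ v → toℕ (f v) ≡ ℓ v
  toℕ-f v = toℕ-fromℕ< (ℓ<m v)
  subst-ℓ : ∀ {A : Set} {i} v → (ℓ v ≡ i → A) × (A → ℓ v ≡ i) → (toℕ (f v) ≡ i → A) × (A → toℕ (f v) ≡ i)
  subst-ℓ v (to , from) = to ∘ trans (sym (toℕ-f v)) , trans (toℕ-f v) ∘ from

CellsAdjacent : Maybe (Fin 3) → Maybe (Fin 3) → Set
CellsAdjacent a b = ((a ≡ just 2F × b ≡ nothing) ⊎ (a ≡ nothing × b ≡ just 2F))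
                  ⊎ ∃[ i ] ∃[ j ] (a ≡ just i × b ≡ just j × CycAdjacent 3 i j)

module BoundedDistance {n} (G : Graph n) (r : Fin n) (B : ℕ) where

  walkTo : ℕ → Fin n → Bool
  walkTo zero v = ⌊ v ≟ r ⌋
  walkTo (suc t) v = ⌊ any? (λ u → T? (walkTo t u ∧ adj G u v)) ⌋

  walkTo-zero : ∀ {v} → T (walkTo 0 v) → v ≡ r
  walkTo-zero = toWitness

  walkTo-last : ∀ {t v} → T (walkTo (suc t) v) → ∃[ u ] T (walkTo t u) × Adj G u v
  walkTo-last {t} w with toWitness w
  ... | u , w∧a = u , Equivalence.to (Bool.T-∧ {walkTo t u}) w∧a

  walkTo-extend : ∀ {t u v} → T (walkTo t u) → Adj G u v → T (walkTo (suc t) v)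
  walkTo-extend {t} {u} w a = fromWitness (u , Equivalence.from (Bool.T-∧ {walkTo t u}) (w , a))

  -- truncated at B: vertices with no walk of length < B from r get distance B
  dist : Fin n → ℕ
  dist v = least (λ t → walkTo t v) B

  dist-minimal : ∀ {t v} → T (walkTo t v) → dist v ≤ t
  dist-minimal {t} {v} = least-minimal (λ t → walkTo t v) B t

  dist-walk : ∀ {v} → dist v < B → T (walkTo (dist v) v)
  dist-walk {v} = least-holds (λ t → walkTo t v) B

  dist-root : dist r ≡ 0
  dist-root = ≤-antisym (dist-minimal {0} (fromWitness refl)) z≤n

  walk-of-dist : ∀ {t v} → dist v ≡ t → t < B → T (walkTo t v)
  walk-of-dist refl = dist-walk

  dist-step : ∀ {u v} → dist u < B → Adj G u v → dist v ≤ suc (dist u)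
  dist-step {u} du<B a = dist-minimal (walkTo-extend {dist u} (dist-walk du<B) a)

  walkTo-colour : ∀ {β} → ProperBoolColouring G β → ∀ t {v} → T (walkTo t v) → β v ≡ nots t (β r)
  walkTo-colour proper zero w = cong _ (walkTo-zero w)
  walkTo-colour proper (suc t) w with walkTo-last {t} w
  ... | u , wu , a = trans (colour-flips G proper a) (cong not (walkTo-colour proper t wu))

  record Geodesic (v : Fin n) (t : ℕ) : Set where
    field
      vertex     : ℕ → Fin n
      start      : vertex 0 ≡ v
      end        : vertex t ≡ r
      step       : ∀ i → i < t → Adj G (vertex (suc i)) (vertex i)
      dist-along : ∀ i → i ≤ t → dist (vertex i) + i ≡ t

    vertex-injective : ∀ {i j} → i ≤ t → j ≤ t → vertex i ≡ vertex j → i ≡ j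
    vertex-injective {i} {j} i≤t j≤t e = +-cancelˡ-≡ (dist (vertex i)) i j
      (trans (dist-along i i≤t) (sym (subst (λ w → dist w + j ≡ t) (sym e) (dist-along j j≤t))))

    toCycle : (K : Graph n) → (∀ {a b} → Adj G a b → Adj K a b) → Adj K r v → 2 ≤ t → Cycle K (suc t)
    toCycle K G⊆K rv 2≤t = record
      { len≥3 = s≤s 2≤t
      ; vert  = vertex ∘ toℕ
      ; inj   = λ {i} {j} e → toℕ-injective (vertex-injective (s≤s⁻¹ (toℕ<n i)) (s≤s⁻¹ (toℕ<n j)) e)
      ; edges = edges
      }
      where
      edges : ∀ i j → CycStep (suc t) i j → Adj K (vertex (toℕ i)) (vertex (toℕ j))
      edges i j (inj₁ 1+i≡j) = subst (Adj K (vertex (toℕ i)) ∘ vertex) 1+i≡j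
        (Adj-sym K (G⊆K (step (toℕ i) (s≤s⁻¹ (subst (_< suc t) (sym 1+i≡j) (toℕ<n j))))))
      edges i j (inj₂ (1+i≡1+t , j≡0)) = subst₂ (Adj K)
        (trans (sym end) (cong vertex (sym (suc-injective 1+i≡1+t))))
        (trans (sym start) (cong vertex (sym j≡0))) rv

  geodesic : ∀ t {v} → dist v ≡ t → t < B → Geodesic v t
  geodesic zero {v} dv≡0 0<B = record
    { vertex = λ _ → v ; start = refl ; end = walkTo-zero (walk-of-dist dv≡0 0<B)
    ; step = λ _ () ; dist-along = λ { zero _ → trans (+-identityʳ _) dv≡0 } }
  geodesic (suc t) {v} dv≡1+t 1+t<B with walkTo-last {t} (walk-of-dist dv≡1+t 1+t<B)
  ... | u , wu , uv = record
    { vertex = λ { zero → v ; (suc i) → vertex i }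
    ; start = refl
    ; end = end
    ; step = λ { zero _ → subst (λ w → Adj G w v) (sym start) uv ; (suc i) i<t → step i (s≤s⁻¹ i<t) }
    ; dist-along = λ { zero _ → trans (+-identityʳ _) dv≡1+t
                     ; (suc i) i≤t → trans (+-suc _ i) (cong suc (dist-along i (s≤s⁻¹ i≤t))) }
    }
    where
    t<B = ≤-trans (n≤1+n _) 1+t<B
    du≡t : dist u ≡ t
    du≡t = ≤-antisym (dist-minimal wu)
      (s≤s⁻¹ (subst (_≤ suc (dist u)) dv≡1+t (dist-step (≤-<-trans (dist-minimal wu) t<B) uv)))
    open Geodesic (geodesic t du≡t t<B)

module AlmostBipartite {n} (H : Graph n) {x y : Fin n} (xy : Adj H x y) (β : Fin n → Bool)
  (proper : ProperBoolColouring (deleteEdge H x y) β) (same : β x ≡ β y) where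

  H' : Graph n
  H' = deleteEdge H x y

  x≢y : x ≢ y
  x≢y = Adj-irrefl H xy

  edge-avoiding-x : ∀ {u v} → Adj H u v → u ≢ x → v ≢ x → Adj H' u v
  edge-avoiding-x a u≢x v≢x = deleteEdge-intro H a (u≢x ∘ proj₁) (v≢x ∘ proj₂)

  edge-leaving-xy : ∀ {u v} → Adj H u v → v ≢ x → v ≢ y → Adj H' u v
  edge-leaving-xy a v≢x v≢y = deleteEdge-intro H a (v≢y ∘ proj₂) (v≢x ∘ proj₂)

  data Side (v : Fin n) : Set where
    at-x   : v ≡ x → Side v
    at-y   : v ≡ y → Side v
    across : v ≢ x → v ≢ y → β v ≢ β y → Side v
    beside : v ≢ x → v ≢ y → β v ≡ β y → Side v

  side : ∀ v → Side v
  side v with v ≟ x | v ≟ y | β v Bool.≟ β y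
  ... | yes v≡x | _       | _    = at-x v≡x
  ... | no _    | yes v≡y | _    = at-y v≡y
  ... | no v≢x  | no v≢y  | no d = across v≢x v≢y d
  ... | no v≢x  | no v≢y  | yes e = beside v≢x v≢y e

  cell : ∀ {v} → Side v → Maybe (Fin 3)
  cell (at-x _)       = just 0F
  cell (at-y _)       = just 1F
  cell (across _ _ _) = just 2F
  cell (beside _ _ _) = nothing

  colours-differ : ∀ {u v} → Adj H u v → v ≢ x → v ≢ y → β u ≢ β v
  colours-differ a v≢x v≢y = proper _ _ (edge-leaving-xy a v≢x v≢y)

  cells-adjacent : ∀ {u v} → Adj H u v → (su : Side u) (sv : Side v) → CellsAdjacent (cell su) (cell sv)
  cells-adjacent a (at-x refl) (at-x refl) = contradiction refl (Adj-irrefl H a)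
  cells-adjacent a (at-x _) (at-y _) = inj₂ (0F , 1F , refl , refl , inj₁ (inj₁ refl))
  cells-adjacent a (at-x _) (across _ _ _) = inj₂ (0F , 2F , refl , refl , inj₂ (inj₂ (refl , refl)))
  cells-adjacent a (at-x refl) (beside v≢x v≢y e) = ⊥-elim (colours-differ a v≢x v≢y (trans same (sym e)))
  cells-adjacent a (at-y _) (at-x _) = inj₂ (1F , 0F , refl , refl , inj₂ (inj₁ refl))
  cells-adjacent a (at-y refl) (at-y refl) = contradiction refl (Adj-irrefl H a)
  cells-adjacent a (at-y _) (across _ _ _) = inj₂ (1F , 2F , refl , refl , inj₁ (inj₁ refl))
  cells-adjacent a (at-y refl) (beside v≢x v≢y e) = ⊥-elim (colours-differ a v≢x v≢y (sym e))
  cells-adjacent a (across _ _ _) (at-x _) = inj₂ (2F , 0F , refl , refl , inj₁ (inj₂ (refl , refl)))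
  cells-adjacent a (across _ _ _) (at-y _) = inj₂ (2F , 1F , refl , refl , inj₂ (inj₁ refl))
  cells-adjacent a (across _ _ du) (across v≢x v≢y dv) =
    ⊥-elim (colours-differ a v≢x v≢y (trans (Bool.¬-not du) (sym (Bool.¬-not dv))))
  cells-adjacent a (across _ _ _) (beside _ _ _) = inj₁ (inj₁ (refl , refl))
  cells-adjacent a (beside u≢x u≢y e) (at-x refl) = ⊥-elim (colours-differ (Adj-sym H a) u≢x u≢y (trans same (sym e)))
  cells-adjacent a (beside u≢x u≢y e) (at-y refl) = ⊥-elim (colours-differ (Adj-sym H a) u≢x u≢y (sym e))
  cells-adjacent a (beside _ _ _) (across _ _ _) = inj₁ (inj₂ (refl , refl))
  cells-adjacent a (beside _ _ eu) (beside v≢x v≢y ev) = ⊥-elim (colours-differ a v≢x v≢y (trans eu (sym ev)))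

  cell-x : ∀ {v} (s : Side v) → (cell s ≡ just 0F → v ≡ x) × (v ≡ x → cell s ≡ just 0F)
  cell-x (at-x v≡x)       = (λ _ → v≡x) , λ _ → refl
  cell-x (at-y v≡y)       = (λ ()) , λ v≡x → contradiction (trans (sym v≡x) v≡y) x≢y
  cell-x (across v≢x _ _) = (λ ()) , λ v≡x → contradiction v≡x v≢x
  cell-x (beside v≢x _ _) = (λ ()) , λ v≡x → contradiction v≡x v≢x

  cell-y : ∀ {v} (s : Side v) → (cell s ≡ just 1F → v ≡ y) × (v ≡ y → cell s ≡ just 1F)
  cell-y (at-x v≡x)       = (λ ()) , λ v≡y → contradiction (trans (sym v≡x) v≡y) x≢y
  cell-y (at-y v≡y)       = (λ _ → v≡y) , λ _ → refl
  cell-y (across _ v≢y _) = (λ ()) , λ v≡y → contradiction v≡y v≢y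
  cell-y (beside _ v≢y _) = (λ ()) , λ v≡y → contradiction v≡y v≢y

  partition₁ : Partition1 H x y
  partition₁ = cell ∘ side , cell-x ∘ side , cell-y ∘ side , λ u v a → cells-adjacent a (side u) (side v)

  module Distances (B : ℕ) where
    open BoundedDistance H' y B public

    x-far : OddGirth≥ H (suc B) → B ≤ dist x
    x-far girth = ≮⇒≥ λ dx<B →
      let w = dist-walk dx<B
          x-even = trans (sym (walkTo-colour proper (dist x) w)) same
          s , dx≡2s = nots-fixed⇒even _ _ x-even
          cycle = Geodesic.toCycle (geodesic (dist x) refl dx<B) H (deleteEdge-⊆ H) (Adj-sym H xy)
                    (two≤ (dist x) w x-even)
      in <-irrefl refl (<-≤-trans dx<B (s≤s⁻¹ (girth _ (s , cong suc dx≡2s) cycle)))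
      where
      two≤ : ∀ t → T (walkTo t x) → nots t (β y) ≡ β y → 2 ≤ t
      two≤ zero w _ = contradiction (walkTo-zero w) x≢y
      two≤ (suc zero) _ e = contradiction (sym e) (Bool.not-¬ refl)
      two≤ (suc (suc _)) _ _ = s≤s (s≤s z≤n)

    adjacent-distances-differ : ∀ {u v} → Adj H' u v → dist u < B → dist v < B → dist u ≢ dist v
    adjacent-distances-differ {u} {v} a du<B dv<B du≡dv = proper u v a (begin
      β u                   ≡⟨ walkTo-colour proper (dist u) (dist-walk du<B) ⟩
      nots (dist u) (β y)   ≡⟨ cong (λ t → nots t (β y)) du≡dv ⟩
      nots (dist v) (β y)   ≡⟨ walkTo-colour proper (dist v) (dist-walk dv<B) ⟨
      β v                   ∎)
      where open ≡-Reasoning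

  module Layers (j : ℕ) (girth : OddGirth≥ H (5 + 2 * j)) where
    -- the 2k of the statement, for k = j + 2
    B : ℕ
    B = 4 + 2 * j

    open Distances B

    data Band (v : Fin n) : Set where
      near     : dist v < B → Band v
      far-even : B ≤ dist v → β v ≡ β y → Band v
      far-odd  : B ≤ dist v → β v ≢ β y → Band v

    data Zone (v : Fin n) : Set where
      at-x : v ≡ x → Zone v
      away : v ≢ x → Band v → Zone v

    band : ∀ v → Band v
    band v with dist v <? B | β v Bool.≟ β y
    ... | yes dv<B | _    = near dv<B
    ... | no dv≮B  | yes e = far-even (≮⇒≥ dv≮B) e
    ... | no dv≮B  | no d  = far-odd (≮⇒≥ dv≮B) d

    zone : ∀ v → Zone v
    zone v with v ≟ x
    ... | yes v≡x = at-x v≡x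
    ... | no v≢x  = away v≢x (band v)

    height : ∀ {v} → Band v → ℕ
    height {v} (near _) = suc (dist v)
    height (far-even _ _) = 3 + 2 * j
    height (far-odd _ _)  = B

    position : ∀ {v} → Zone v → ℕ
    position (at-x _)   = 0
    position (away _ b) = height b

    far⇒≢y : ∀ {v} → B ≤ dist v → v ≢ y
    far⇒≢y B≤dv refl with subst (B ≤_) dist-root B≤dv
    ... | ()

    near-next-to-far : ∀ {u v} → Adj H' u v → dist u < B → B ≤ dist v → suc (dist u) ≡ B × β v ≡ β y
    near-next-to-far {u} {v} a du<B B≤dv = 1+du≡B , (begin
      β v                                ≡⟨ colour-flips H' proper a ⟩
      not (β u)                          ≡⟨ cong not (walkTo-colour proper (dist u) (dist-walk du<B)) ⟩
      nots (suc (dist u)) (β y)          ≡⟨ cong (λ t → nots t (β y)) 1+du≡B ⟩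
      not (not (nots (2 + 2 * j) (β y))) ≡⟨ Bool.not-involutive _ ⟩
      not (not (nots (2 * j) (β y)))     ≡⟨ Bool.not-involutive _ ⟩
      nots (2 * j) (β y)                 ≡⟨ nots-even j (β y) ⟩
      β y                                ∎)
      where
      open ≡-Reasoning
      1+du≡B = ≤-antisym du<B (≤-trans B≤dv (dist-step du<B a))

    bands-adjacent : ∀ {u v} → Adj H' u v → (bu : Band u) (bv : Band v)
                   → CycAdjacentℕ (suc B) (height bu) (height bv)
    bands-adjacent a (near du<B) (near dv<B)
      with within1∧≢⇒consecutive (dist-step dv<B (Adj-sym H' a)) (dist-step du<B a)
                                 (adjacent-distances-differ a du<B dv<B)
    ... | inj₁ 1+du≡dv = inj₁ (inj₁ (cong suc 1+du≡dv))
    ... | inj₂ 1+dv≡du = inj₂ (inj₁ (cong suc 1+dv≡du))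
    bands-adjacent a (near du<B) (far-even B≤dv _) = inj₂ (inj₁ (sym (proj₁ (near-next-to-far a du<B B≤dv))))
    bands-adjacent a (near du<B) (far-odd B≤dv d)  = ⊥-elim (d (proj₂ (near-next-to-far a du<B B≤dv)))
    bands-adjacent a (far-even B≤du _) (near dv<B) =
      inj₁ (inj₁ (sym (proj₁ (near-next-to-far (Adj-sym H' a) dv<B B≤du))))
    bands-adjacent a (far-odd B≤du d) (near dv<B)  = ⊥-elim (d (proj₂ (near-next-to-far (Adj-sym H' a) dv<B B≤du)))
    bands-adjacent a (far-even _ eu) (far-even _ ev) = ⊥-elim (proper _ _ a (trans eu (sym ev)))
    bands-adjacent a (far-even _ _) (far-odd _ _)    = inj₁ (inj₁ refl)
    bands-adjacent a (far-odd _ _) (far-even _ _)    = inj₂ (inj₁ refl)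
    bands-adjacent a (far-odd _ du) (far-odd _ dv)   =
      ⊥-elim (proper _ _ a (trans (Bool.¬-not du) (sym (Bool.¬-not dv))))

    neighbours-of-x : ∀ {v} → Adj H x v → v ≢ x → (bv : Band v) → CycAdjacentℕ (suc B) 0 (height bv)
    neighbours-of-x {v} a v≢x (near dv<B) = y-or-last-layer (v ≟ y)
      where
      y-or-last-layer : Dec (v ≡ y) → CycAdjacentℕ (suc B) 0 (suc (dist v))
      y-or-last-layer (yes refl) = inj₁ (inj₁ (cong suc (sym dist-root)))
      y-or-last-layer (no v≢y)   = inj₂ (inj₂ (cong suc 1+dv≡B , refl))
        where
        xv = edge-leaving-xy a v≢x v≢y
        1+dv≡B = ≤-antisym dv<B (≤-trans (x-far girth) (dist-step dv<B (Adj-sym H' xv)))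
    neighbours-of-x a v≢x (far-even B≤dv e) = ⊥-elim (colours-differ a v≢x (far⇒≢y B≤dv) (trans same (sym e)))
    neighbours-of-x a v≢x (far-odd _ _)     = inj₂ (inj₂ (refl , refl))

    positions-adjacent : ∀ {u v} → Adj H u v → (zu : Zone u) (zv : Zone v)
                       → CycAdjacentℕ (suc B) (position zu) (position zv)
    positions-adjacent a (at-x refl)   (at-x refl)   = contradiction refl (Adj-irrefl H a)
    positions-adjacent a (at-x refl)   (away v≢x bv) = neighbours-of-x a v≢x bv
    positions-adjacent a (away u≢x bu) (at-x refl)   = CycAdjacentℕ-sym (neighbours-of-x (Adj-sym H a) u≢x bu)
    positions-adjacent a (away u≢x bu) (away v≢x bv) = bands-adjacent (edge-avoiding-x a u≢x v≢x) bu bv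

    position-bound : ∀ {v} (z : Zone v) → position z < suc B
    position-bound (at-x _)                = s≤s z≤n
    position-bound (away _ (near dv<B))    = s≤s dv<B
    position-bound (away _ (far-even _ _)) = s≤s (n≤1+n _)
    position-bound (away _ (far-odd _ _))  = ≤-refl

    position-x : ∀ {v} (z : Zone v) → (position z ≡ 0 → v ≡ x) × (v ≡ x → position z ≡ 0)
    position-x (at-x v≡x)   = (λ _ → v≡x) , λ _ → refl
    position-x (away v≢x b) = (λ p≡0 → ⊥-elim (height≢0 b p≡0)) , λ v≡x → contradiction v≡x v≢x
      where
      height≢0 : ∀ {v} (b : Band v) → height b ≢ 0
      height≢0 (near _) ()
      height≢0 (far-even _ _) ()
      height≢0 (far-odd _ _) ()

    position-y : ∀ {v} (z : Zone v) → (position z ≡ 1 → v ≡ y) × (v ≡ y → position z ≡ 1)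
    position-y (at-x v≡x) = (λ ()) , λ v≡y → contradiction (trans (sym v≡x) v≡y) x≢y
    position-y (away _ (near dv<B)) =
      (λ 1+dv≡1 → walkTo-zero (walk-of-dist (suc-injective 1+dv≡1) (s≤s z≤n))) , λ { refl → cong suc dist-root }
    position-y (away _ (far-even B≤dv _)) = (λ ()) , λ v≡y → contradiction v≡y (far⇒≢y B≤dv)
    position-y (away _ (far-odd B≤dv _))  = (λ ()) , λ v≡y → contradiction v≡y (far⇒≢y B≤dv)

    partition₂ : Partition2 H x y (suc B)
    partition₂ = partition₂-fromℕ H (position ∘ zone) (position-bound ∘ zone) (position-x ∘ zone)
      (position-y ∘ zone) λ u v a → positions-adjacent a (zone u) (zone v)

  cycle-partition : ∀ k → 2 ≤ k → OddGirth≥ H (2 * k + 1) → Partition2 H x y (2 * k + 1)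
  cycle-partition (suc (suc j)) (s≤s (s≤s z≤n)) girth =
    subst (Partition2 H x y) (sym 2k+1≡5+2j) (Layers.partition₂ j (subst (OddGirth≥ H) 2k+1≡5+2j girth))
    where
    2k+1≡5+2j : 2 * (2 + j) + 1 ≡ 5 + 2 * j
    2k+1≡5+2j = trans (+-comm (2 * (2 + j)) 1) (cong suc (*-distribˡ-+ 2 2 j))

lemma5p1 : (k : ℕ) → 1 ≤ k → (n : ℕ) → (H : Graph n) → (x y : Fin n)
         → ChromaticNumber≡ H 3 → CriticalEdge H x y → OddGirth≥ H (2 * k + 1)
         → Partition1 H x y × (2 ≤ k → Partition2 H x y (2 * k + 1))
lemma5p1 k _ n H x y χ critical girth =
  let β , proper , same = criticalEdge⇒almostBipartite {H = H} χ critical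
      open AlmostBipartite H (proj₁ critical) β proper same
  in partition₁ , λ 2≤k → cycle-partition k 2≤k girth
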